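{- Let $L$ be either of the systems $\mathsf{LPV}^-$ or $\mathsf{LPV}$ described in the context. Then the ${\bf V}$-necessitation rule is derivable in $L$: for every formula $A$, if $L \vdash A$ then $L \vdash {\bf V} A$.
   Context: The language of $\mathsf{LPV}^-$: formulas of classical propositional logic (propositional letters, $\bot$, $\neg,\land,\lor,\rightarrow$) extended by a unary modal operator ${\bf V}$ and by formulas $t{:}A$ ("$t$ is a proof of $A$"), where proof terms $t$ are built from proof variables $x,y,\dots$ and proof constants $a,b,c,\dots$ by the binary operations $\cdot$ (application) and $+$ (plus) and the unary operation $!$ (proof checker). If $A,B$ are formulas and $t$ a term, then $\neg A$, $A\land B$, $A\lor B$, $A\rightarrow B$, ${\bf V}A$, $t{:}A$ are formulas. Axioms of $\mathsf{LPV}^-$: (E0) axioms of classical propositional logic; (E1) $t{:}(A\rightarrow B)\rightarrow(s{:}A\rightarrow (t\cdot s){:}B)$; (E2) $t{:}A\rightarrow A$; (E3) $t{:}A\rightarrow\, !t{:}t{:}A$; (E4) $t{:}A\rightarrow (s+t){:}A$ and $t{:}A\rightarrow (t+s){:}A$; (E5) ${\bf V}(A\rightarrow B)\rightarrow({\bf V}A\rightarrow {\bf V}B)$; (E6) $t{:}A\rightarrow {\bf V}A$. Rules: Modus Ponens, and Axiom Necessitation: from $\vdash A$ with $A$ an axiom infer $\vdash c{:}A$ for a proof constant $c$. The system $\mathsf{LPV}$ is $\mathsf{LPV}^-$ with the additional axiom (E7) $\neg t{:}{\bf V}\bot$ for every proof term $t$. -}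

module Defs where

open import Data.Nat using (ℕ)

data Term : Set where
  var   : ℕ → Term
  const : ℕ → Term
  _·_   : Term → Term → Term
  _⊕_   : Term → Term → Term
  !_    : Term → Term

data Fm : Set where
  atom  : ℕ → Fm
  ⊥'    : Fm
  ¬'_   : Fm → Fm
  _∧'_  : Fm → Fm → Fm
  _∨'_  : Fm → Fm → Fm
  _⇒_   : Fm → Fm → Fm
  V     : Fm → Fm
  _∶_   : Term → Fm → Fm

infixr 5 _⇒_
infixl 7 _∧'_
infixl 6 _∨'_
infix 9 _∶_

data Prop0 : Fm → Set where
  k     : ∀ A B → Prop0 (A ⇒ B ⇒ A)
  s     : ∀ A B C → Prop0 ((A ⇒ B ⇒ C) ⇒ (A ⇒ B) ⇒ A ⇒ C)
  ∧e₁   : ∀ A B → Prop0 (A ∧' B ⇒ A)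
  ∧e₂   : ∀ A B → Prop0 (A ∧' B ⇒ B)
  ∧i    : ∀ A B → Prop0 (A ⇒ B ⇒ A ∧' B)
  ∨i₁   : ∀ A B → Prop0 (A ⇒ A ∨' B)
  ∨i₂   : ∀ A B → Prop0 (B ⇒ A ∨' B)
  ∨e    : ∀ A B C → Prop0 ((A ⇒ C) ⇒ (B ⇒ C) ⇒ A ∨' B ⇒ C)
  ⊥e    : ∀ A → Prop0 (⊥' ⇒ A)
  ¬i    : ∀ A → Prop0 ((A ⇒ ⊥') ⇒ ¬' A)
  ¬e    : ∀ A → Prop0 (¬' A ⇒ A ⇒ ⊥')
  dne   : ∀ A → Prop0 (((A ⇒ ⊥') ⇒ ⊥') ⇒ A)

data AxLPV⁻ : Fm → Set where
  E0  : ∀ {A} → Prop0 A → AxLPV⁻ A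
  E1  : ∀ t s A B → AxLPV⁻ (t ∶ (A ⇒ B) ⇒ s ∶ A ⇒ (t · s) ∶ B)
  E2  : ∀ t A → AxLPV⁻ (t ∶ A ⇒ A)
  E3  : ∀ t A → AxLPV⁻ (t ∶ A ⇒ (! t) ∶ (t ∶ A))
  E4l : ∀ t s A → AxLPV⁻ (t ∶ A ⇒ (s ⊕ t) ∶ A)
  E4r : ∀ t s A → AxLPV⁻ (t ∶ A ⇒ (t ⊕ s) ∶ A)
  E5  : ∀ A B → AxLPV⁻ (V (A ⇒ B) ⇒ V A ⇒ V B)
  E6  : ∀ t A → AxLPV⁻ (t ∶ A ⇒ V A)

data AxLPV : Fm → Set where
  base : ∀ {A} → AxLPV⁻ A → AxLPV A
  E7   : ∀ t → AxLPV (¬' (t ∶ V ⊥'))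

data System : Set where
  LPV⁻ LPV : System

Ax : System → Fm → Set
Ax LPV⁻ = AxLPV⁻
Ax LPV  = AxLPV

data _⊢_ (L : System) : Fm → Set where
  ax  : ∀ {A} → Ax L A → L ⊢ A
  mp  : ∀ {A B} → L ⊢ (A ⇒ B) → L ⊢ A → L ⊢ B
  an  : ∀ {A} (c : ℕ) → Ax L A → L ⊢ (const c ∶ A)

infix 3 _⊢_

module Submission where

open import Defs

-- The proof is by induction on the derivation of A, and only the
-- LPV⁻-axioms (E3), (E5), (E6) are used, so it works uniformly for both
-- systems once every LPV⁻-axiom is recognised as an axiom of L.
--   * Axiom A:  Axiom Necessitation gives c:A, and (E6) turns it into V A.
--   * Axiom Necessitation c:B:  (E3) gives !c:(c:B), and (E6) turns this
--     proof assertion into V(c:B).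
--   * Modus Ponens from A → B and A:  by induction V(A → B) and V A, and
--     (E5) distributes V over the implication.

lpv⁻-axiom : (L : System) {A : Fm} → AxLPV⁻ A → Ax L A
lpv⁻-axiom LPV⁻ a = a
lpv⁻-axiom LPV  a = base a

proved⇒verified : {L : System} {t : Term} {A : Fm} → L ⊢ t ∶ A → L ⊢ V A
proved⇒verified {L} {t} {A} d = mp (ax (lpv⁻-axiom L (E6 t A))) d

proof-checker : {L : System} {t : Term} {A : Fm} → L ⊢ t ∶ A → L ⊢ (! t) ∶ (t ∶ A)
proof-checker {L} {t} {A} d = mp (ax (lpv⁻-axiom L (E3 t A))) d

verified-mp : {L : System} {A B : Fm} → L ⊢ V (A ⇒ B) → L ⊢ V A → L ⊢ V B
verified-mp {L} {A} {B} dAB dA = mp (mp (ax (lpv⁻-axiom L (E5 A B))) dAB) dA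

lemma1 : (L : System) (A : Fm) → L ⊢ A → L ⊢ V A
lemma1 L A       (ax a)   = proved⇒verified (an 0 a)
lemma1 L A       (mp d e) = verified-mp (lemma1 L _ d) (lemma1 L _ e)
lemma1 L .(_ ∶ _) (an c a) = proved⇒verified (proof-checker (an c a))
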